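{- The Boolean lattice $B_3$ of subsets of $\{1,2,3\}$ ordered by inclusion satisfies $\chi_D(B_3)=5$.
   Context: For a finite poset $P$, a coloring is proper if comparable points get different colors and distinguishing if the only color-preserving automorphism of $P$ is the identity; $\chi_D(P)$ is the least number of colors in a proper distinguishing coloring of $P$. -}

module Defs where

open import Data.Nat using (ℕ; _<_)
open import Data.Fin using (Fin)
open import Data.Fin.Subset using (Subset; _⊆_)
open import Data.Product using (Σ; _×_; ∃-syntax)
open import Data.Sum using (_⊎_)
open import Function.Bundles using (_↔_; Inverse)
open import Relation.Binary.PropositionalEquality using (_≡_; _≢_)
open import Relation.Nullary using (¬_)

module _ {A : Set} (_≤_ : A → A → Set) where

  Comparable : A → A → Set
  Comparable x y = (x ≤ y) ⊎ (y ≤ x)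

  Proper : {k : ℕ} → (A → Fin k) → Set
  Proper c = ∀ x y → x ≢ y → Comparable x y → c x ≢ c y

  IsAutomorphism : A ↔ A → Set
  IsAutomorphism σ = ∀ x y → (x ≤ y → Inverse.to σ x ≤ Inverse.to σ y)
                              × (Inverse.to σ x ≤ Inverse.to σ y → x ≤ y)

  Distinguishing : {k : ℕ} → (A → Fin k) → Set
  Distinguishing c = ∀ (σ : A ↔ A) → IsAutomorphism σ →
                     (∀ x → c (Inverse.to σ x) ≡ c x) → ∀ x → Inverse.to σ x ≡ x

  ProperDistinguishing : (k : ℕ) → Set
  ProperDistinguishing k = Σ (A → Fin k) λ c → Proper c × Distinguishing c

  DistinguishingChromaticNumberIs : ℕ → Set
  DistinguishingChromaticNumberIs n =
    ProperDistinguishing n × (∀ k → k < n → ¬ ProperDistinguishing k)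

B₃ : Set
B₃ = Subset 3

_≤B₃_ : B₃ → B₃ → Set
_≤B₃_ = _⊆_

module Submission where

-- A proper colouring is injective on every chain (a set of
-- pairwise comparable points), so by the pigeonhole principle the chain
-- ∅ ⊂ {0} ⊂ {0,1} ⊂ {0,1,2} forces at least 4 colours.  With exactly 4
-- colours every chain of length 4 uses the whole palette, so a point
-- comparable with three members of such a chain must repeat the colour of
-- the fourth.  This forces c{0} = c{1} and c{0,2} = c{1,2}; hence the
-- automorphism of B₃ induced by swapping the letters 0 and 1 preserves the
-- colouring, which is therefore not distinguishing.
--
-- Give ∅ and {0,1,2} colours of their own and each atom {i}
-- the same colour as its complement.  The colour classes are then contained
-- in pairs {p, ∁ p}; as p and ∁ p are comparable only for p = ∅ or the full
-- set, the colouring is proper.  A colour-preserving automorphism σ maps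
-- every p to p or ∁ p, and a comparable neighbour w of each middle-rank p,
-- chosen so that ∁ p relates neither to w nor to ∁ w, rules out σ p = ∁ p.

open import Defs
open import Data.Nat as ℕ using (suc; _≤_)
open import Data.Nat.Properties using (m<1+n⇒m<n∨m≡n; <⇒≱; 1+n≰n)
open import Data.Fin using (Fin; #_; _≟_)
open import Data.Fin.Properties using (injective⇒≤)
open import Data.Fin.Permutation using (Permutation′; _⟨$⟩ʳ_; _⟨$⟩ˡ_; inverseˡ; inverseʳ; transpose)
open import Data.Fin.Subset using (Subset; _⊆_; _⊇_; _∈_; ⊥; ⊤; ∁; ⁅_⁆; inside; outside)
open import Data.Fin.Subset.Properties
  using (_⊆?_; _∈?_; anySubset?; x∈p⇒x∉∁p; x∉p⇒x∈∁p; Empty-unique; ⊆-antisym; ⊆⊤)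
open import Data.Vec using (Vec; []; _∷_; map; lookup; tabulate)
open import Data.Vec.Properties using (≡-dec; []=⇒lookup; lookup⇒[]=; lookup∘tabulate; tabulate∘lookup; tabulate-cong)
open import Data.Vec.Relation.Unary.All using (All; _∷_)
open import Data.Vec.Relation.Unary.AllPairs as AllPairs using (AllPairs; _∷_; allPairs?)
open import Data.Vec.Relation.Unary.AllPairs.Properties using (map⁺)
open import Data.Vec.Relation.Unary.Unique.Propositional using (Unique)
open import Data.Vec.Relation.Unary.Unique.Propositional.Properties using (lookup-injective)
open import Data.Bool.Properties using () renaming (_≟_ to _≟ᵇ_)
open import Data.Product using (_×_; _,_; proj₁)
open import Data.Sum using (_⊎_; inj₁; inj₂)
open import Function using (_∘_)
open import Function.Bundles using (_↔_; mk↔ₛ′; Inverse)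
open import Relation.Binary.PropositionalEquality
  using (_≡_; _≢_; refl; sym; trans; cong; subst; subst₂; module ≡-Reasoning)
open import Relation.Nullary using (¬_; Dec; yes; no; contradiction)
open import Relation.Nullary.Decidable
  using (True; False; toWitness; toWitnessFalse; from-yes; decidable-stable; ¬?; _×-dec_; _⊎-dec_; _→-dec_)
open import Relation.Unary using (Pred; Decidable)
open import Level using (0ℓ)

Chain : ∀ {A : Set} (_≼_ : A → A → Set) {n} → Vec A n → Set
Chain _≼_ = AllPairs (λ x y → x ≢ y × Comparable _≼_ x y)

chain-colours-unique : ∀ {A : Set} {_≼_ : A → A → Set} {k n} {c : A → Fin k} {xs : Vec A n} →
                       Proper _≼_ c → Chain _≼_ xs → Unique (map c xs)
chain-colours-unique proper chain =
  map⁺ (AllPairs.map (λ (x≢y , x∼y) → proper _ _ x≢y x∼y) chain)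

unique-length : ∀ {k n} {vs : Vec (Fin k) n} → Unique vs → n ≤ k
unique-length unique = injective⇒≤ (λ {i} {j} → lookup-injective unique i j)

chain-bound : ∀ {A : Set} {_≼_ : A → A → Set} {k n} {c : A → Fin k} {xs : Vec A n} →
              Proper _≼_ c → Chain _≼_ xs → n ≤ k
chain-bound proper chain = unique-length (chain-colours-unique proper chain)

-- n+1 distinct colours out of n+1 exhaust the palette: a colour that differs
-- from all of them but the first is the first one.
palette-exhausted : ∀ {n} {u w : Fin (suc n)} {vs : Vec (Fin (suc n)) n} →
                    Unique (u ∷ vs) → All (w ≢_) vs → w ≡ u
palette-exhausted {u = u} {w} unique w∉vs with w ≟ u
... | yes w≡u = w≡u
... | no  w≢u = contradiction (unique-length ((w≢u ∷ w∉vs) ∷ unique)) 1+n≰n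

⊆∁⇒⊥ : ∀ {n} {p : Subset n} → p ⊆ ∁ p → p ≡ ⊥
⊆∁⇒⊥ p⊆∁p = Empty-unique (λ (i , i∈p) → x∈p⇒x∉∁p i∈p (p⊆∁p i∈p))

∁⊆⇒⊤ : ∀ {n} {p : Subset n} → ∁ p ⊆ p → p ≡ ⊤
∁⊆⇒⊤ {p = p} ∁p⊆p = ⊆-antisym ⊆⊤ λ {i} _ →
  decidable-stable (i ∈? p) (λ i∉p → i∉p (∁p⊆p (x∉p⇒x∈∁p i∉p)))

comparable-∁ : ∀ {n} {p : Subset n} → Comparable _⊆_ p (∁ p) → p ≡ ⊥ ⊎ p ≡ ⊤
comparable-∁ (inj₁ p⊆∁p) = inj₁ (⊆∁⇒⊥ p⊆∁p)
comparable-∁ (inj₂ ∁p⊆p) = inj₂ (∁⊆⇒⊤ ∁p⊆p)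

preimage : ∀ {m n} → (Fin m → Fin n) → Subset n → Subset m
preimage f p = tabulate (λ i → lookup p (f i))

∈-preimage⁺ : ∀ {m n} {f : Fin m → Fin n} {p i} → f i ∈ p → i ∈ preimage f p
∈-preimage⁺ {f = f} {p} {i} fi∈p =
  lookup⇒[]= i _ (trans (lookup∘tabulate (lookup p ∘ f) i) ([]=⇒lookup fi∈p))

∈-preimage⁻ : ∀ {m n} {f : Fin m → Fin n} {p i} → i ∈ preimage f p → f i ∈ p
∈-preimage⁻ {f = f} {p} {i} i∈f⁻¹p =
  lookup⇒[]= (f i) p (trans (sym (lookup∘tabulate (lookup p ∘ f) i)) ([]=⇒lookup i∈f⁻¹p))

preimage-mono : ∀ {m n} {f : Fin m → Fin n} {p q} → p ⊆ q → preimage f p ⊆ preimage f q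
preimage-mono p⊆q = ∈-preimage⁺ ∘ p⊆q ∘ ∈-preimage⁻

preimage-inverse : ∀ {n} {f g : Fin n → Fin n} → (∀ i → f (g i) ≡ i) →
                   ∀ p → preimage g (preimage f p) ≡ p
preimage-inverse {f = f} {g} f∘g≗id p = begin
  tabulate (λ i → lookup (preimage f p) (g i)) ≡⟨ tabulate-cong (λ i → lookup∘tabulate (lookup p ∘ f) (g i)) ⟩
  tabulate (λ i → lookup p (f (g i)))           ≡⟨ tabulate-cong (λ i → cong (lookup p) (f∘g≗id i)) ⟩
  tabulate (lookup p)                           ≡⟨ tabulate∘lookup p ⟩
  p                                             ∎
  where open ≡-Reasoning

relabelling : ∀ {n} → Permutation′ n → Subset n ↔ Subset n
relabelling π = mk↔ₛ′ (preimage (π ⟨$⟩ʳ_)) (preimage (π ⟨$⟩ˡ_))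
  (preimage-inverse (λ _ → inverseˡ π)) (preimage-inverse (λ _ → inverseʳ π))

relabelling-isAutomorphism : ∀ {n} (π : Permutation′ n) → IsAutomorphism _⊆_ (relabelling π)
relabelling-isAutomorphism π p q = preimage-mono , reflect
  where
  reflect : preimage (π ⟨$⟩ʳ_) p ⊆ preimage (π ⟨$⟩ʳ_) q → p ⊆ q
  reflect πp⊆πq = subst₂ _⊆_ (preimage-inverse (λ _ → inverseʳ π) p) (preimage-inverse (λ _ → inverseʳ π) q)
                         (preimage-mono πp⊆πq)

allSubsets? : ∀ {n} {P : Pred (Subset n) 0ℓ} → Decidable P → Dec (∀ p → P p)
allSubsets? P? with anySubset? (¬? ∘ P?)
... | yes (p , ¬Pp) = no (λ ∀P → ¬Pp (∀P p))
... | no  ¬∃¬P      = yes (λ p → decidable-stable (P? p) (λ ¬Pp → ¬∃¬P (p , ¬Pp)))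

_≟ₛ_ : ∀ {n} (p q : Subset n) → Dec (p ≡ q)
_≟ₛ_ = ≡-dec _≟ᵇ_

chain? : ∀ {n k} (xs : Vec (Subset n) k) → Dec (Chain _⊆_ xs)
chain? = allPairs? (λ p q → ¬? (p ≟ₛ q) ×-dec ((p ⊆? q) ⊎-dec (q ⊆? p)))

chain! : ∀ {n k} {xs : Vec (Subset n) k} {_ : True (chain? xs)} → Chain _⊆_ xs
chain! {xs = xs} {c} = toWitness {a? = chain? xs} c

⊆! : ∀ {n} {p q : Subset n} {_ : True (p ⊆? q)} → p ⊆ q
⊆! {p = p} {q} {c} = toWitness {a? = p ⊆? q} c

⊈! : ∀ {n} {p q : Subset n} {_ : False (p ⊆? q)} → ¬ p ⊆ q
⊈! {p = p} {q} {c} = toWitnessFalse {a? = p ⊆? q} c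

atom coatom : Fin 3 → B₃
atom i = ⁅ i ⁆
coatom i = ∁ ⁅ i ⁆

colour : B₃ → Fin 5
colour (outside ∷ outside ∷ outside ∷ []) = # 0
colour (inside  ∷ inside  ∷ inside  ∷ []) = # 1
colour (inside  ∷ outside ∷ outside ∷ []) = # 2
colour (outside ∷ inside  ∷ inside  ∷ []) = # 2
colour (outside ∷ inside  ∷ outside ∷ []) = # 3
colour (inside  ∷ outside ∷ inside  ∷ []) = # 3
colour (outside ∷ outside ∷ inside  ∷ []) = # 4
colour (inside  ∷ inside  ∷ outside ∷ []) = # 4

colour-classes : ∀ p q → colour q ≡ colour p → q ≡ p ⊎ q ≡ ∁ p
colour-classes = from-yes (allSubsets? λ p → allSubsets? λ q →
  (colour q ≟ colour p) →-dec ((q ≟ₛ p) ⊎-dec (q ≟ₛ ∁ p)))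

-- Proper: same-coloured points are equal or complementary, and complementary
-- points are comparable only for {∅, full set}, which get different colours.
colour-proper : Proper _⊆_ colour
colour-proper p q p≢q p∼q same with colour-classes p q (sym same)
... | inj₁ q≡p = p≢q (sym q≡p)
... | inj₂ refl with comparable-∁ p∼q
...   | inj₁ refl = contradiction same λ ()
...   | inj₂ refl = contradiction same λ ()

-- Distinguishing: by colour-classes a colour-preserving automorphism σ maps
-- each p to p or ∁ p; the lemmas below exclude the second option.
module ColourPreserving (σ : B₃ ↔ B₃) (automorphism : IsAutomorphism _⊆_ σ)
                        (keeps : ∀ p → colour (Inverse.to σ p) ≡ colour p) where

  σ̂ : B₃ → B₃
  σ̂ = Inverse.to σ

  fixed-by-colour : ∀ p → colour (∁ p) ≢ colour p → σ̂ p ≡ p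
  fixed-by-colour p ∁p≉p with colour-classes p (σ̂ p) (keeps p)
  ... | inj₁ σp≡p  = σp≡p
  ... | inj₂ σp≡∁p = contradiction (trans (cong colour (sym σp≡∁p)) (keeps p)) ∁p≉p

  fixed-by-neighbour : (R : B₃ → B₃ → Set) → (∀ {u v} → R u v → R (σ̂ u) (σ̂ v)) →
                       ∀ p w → R p w → ¬ R (∁ p) w → ¬ R (∁ p) (∁ w) → σ̂ p ≡ p
  fixed-by-neighbour R preserves p w pRw ¬∁pRw ¬∁pR∁w
    with colour-classes p (σ̂ p) (keeps p) | colour-classes w (σ̂ w) (keeps w)
  ... | inj₁ σp≡p  | _          = σp≡p
  ... | inj₂ σp≡∁p | inj₁ σw≡w  = contradiction (subst₂ R σp≡∁p σw≡w (preserves pRw)) ¬∁pRw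
  ... | inj₂ σp≡∁p | inj₂ σw≡∁w = contradiction (subst₂ R σp≡∁p σw≡∁w (preserves pRw)) ¬∁pR∁w

  upward : ∀ {u v} → u ⊆ v → σ̂ u ⊆ σ̂ v
  upward {u} {v} = proj₁ (automorphism u v)

  downward : ∀ {u v} → u ⊇ v → σ̂ u ⊇ σ̂ v
  downward {u} {v} = proj₁ (automorphism v u)

  -- Atoms are pinned by a coatom above them, coatoms by an atom below them.
  fixes-all : ∀ p → σ̂ p ≡ p
  fixes-all (outside ∷ outside ∷ outside ∷ []) = fixed-by-colour _ (λ ())
  fixes-all (inside  ∷ inside  ∷ inside  ∷ []) = fixed-by-colour _ (λ ())
  fixes-all (inside  ∷ outside ∷ outside ∷ []) = fixed-by-neighbour _⊆_ upward (atom (# 0)) (coatom (# 2)) ⊆! ⊈! ⊈!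
  fixes-all (outside ∷ inside  ∷ outside ∷ []) = fixed-by-neighbour _⊆_ upward (atom (# 1)) (coatom (# 2)) ⊆! ⊈! ⊈!
  fixes-all (outside ∷ outside ∷ inside  ∷ []) = fixed-by-neighbour _⊆_ upward (atom (# 2)) (coatom (# 1)) ⊆! ⊈! ⊈!
  fixes-all (inside  ∷ inside  ∷ outside ∷ []) = fixed-by-neighbour _⊇_ downward (coatom (# 2)) (atom (# 0)) ⊆! ⊈! ⊈!
  fixes-all (inside  ∷ outside ∷ inside  ∷ []) = fixed-by-neighbour _⊇_ downward (coatom (# 1)) (atom (# 0)) ⊆! ⊈! ⊈!
  fixes-all (outside ∷ inside  ∷ inside  ∷ []) = fixed-by-neighbour _⊇_ downward (coatom (# 0)) (atom (# 1)) ⊆! ⊈! ⊈!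

colour-distinguishing : Distinguishing _⊆_ colour
colour-distinguishing σ automorphism keeps = ColourPreserving.fixes-all σ automorphism keeps

module FourColours (c : B₃ → Fin 4) (proper : Proper _⊆_ c) where

  -- A chain x ∷ xs of length four uses all four colours, so a point y on a
  -- chain y ∷ ys whose colours repeat those of xs must take the colour of x.
  forced : ∀ x y {xs ys : Vec B₃ 3} → map c ys ≡ map c xs →
           Chain _⊆_ (x ∷ xs) → Chain _⊆_ (y ∷ ys) → c y ≡ c x
  forced x y same-colours x∷xs y∷ys = palette-exhausted (chain-colours-unique proper x∷xs)
    (subst (All (c y ≢_)) same-colours (AllPairs.head (chain-colours-unique proper y∷ys)))

  -- From the chains {0} ⊂ {0,1} and {1} ⊂ {0,1}, both extended by ∅ and the full set.
  atoms-alike : c (atom (# 1)) ≡ c (atom (# 0))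
  atoms-alike = forced (atom (# 0)) (atom (# 1)) {⊥ ∷ coatom (# 2) ∷ ⊤ ∷ []} refl chain! chain!

  -- From the chains {0} ⊂ {0,2} and {1} ⊂ {1,2}, both extended by ∅ and the full set.
  coatoms-alike : c (coatom (# 0)) ≡ c (coatom (# 1))
  coatoms-alike = forced (coatom (# 1)) (coatom (# 0))
    {⊥ ∷ atom (# 0) ∷ ⊤ ∷ []} {⊥ ∷ atom (# 1) ∷ ⊤ ∷ []}
    (cong (λ colour₁ → c ⊥ ∷ colour₁ ∷ c ⊤ ∷ []) atoms-alike) chain! chain!

  swap01 : Permutation′ 3
  swap01 = transpose (# 0) (# 1)

  swap : B₃ ↔ B₃
  swap = relabelling swap01

  swap-keeps-colours : ∀ p → c (Inverse.to swap p) ≡ c p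
  swap-keeps-colours (outside ∷ outside ∷ outside ∷ []) = refl
  swap-keeps-colours (inside  ∷ inside  ∷ inside  ∷ []) = refl
  swap-keeps-colours (outside ∷ outside ∷ inside  ∷ []) = refl
  swap-keeps-colours (inside  ∷ inside  ∷ outside ∷ []) = refl
  swap-keeps-colours (inside  ∷ outside ∷ outside ∷ []) = atoms-alike
  swap-keeps-colours (outside ∷ inside  ∷ outside ∷ []) = sym atoms-alike
  swap-keeps-colours (inside  ∷ outside ∷ inside  ∷ []) = coatoms-alike
  swap-keeps-colours (outside ∷ inside  ∷ inside  ∷ []) = sym coatoms-alike

  not-distinguishing : ¬ Distinguishing _⊆_ c
  not-distinguishing distinguishing =
    contradiction (distinguishing swap (relabelling-isAutomorphism swap01) swap-keeps-colours (atom (# 0))) λ ()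

fewer-than-five : ∀ k → k ℕ.< 5 → ¬ ProperDistinguishing _⊆_ k
fewer-than-five k k<5 (c , proper , distinguishing) with m<1+n⇒m<n∨m≡n k<5
... | inj₁ k<4  = <⇒≱ k<4 (chain-bound proper (chain! {xs = ⊥ ∷ atom (# 0) ∷ coatom (# 2) ∷ ⊤ ∷ []}))
... | inj₂ refl = FourColours.not-distinguishing c proper distinguishing

proposition4p10 : DistinguishingChromaticNumberIs _≤B₃_ 5
proposition4p10 = (colour , colour-proper , colour-distinguishing) , fewer-than-five
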